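{- Let $H$ be a graph of order $n\ge 2$ and $k\in\{1,\ldots,\mathcal{C}(K_1+H)\}$. Then $\operatorname{adim}_k(K_1+H)\ge\operatorname{adim}_k(H)$.
   Context: All graphs are finite and simple. The join $G+H$ of vertex-disjoint graphs $G,H$ has vertex set $V(G)\cup V(H)$ and edge set $E(G)\cup E(H)\cup\{uv: u\in V(G), v\in V(H)\}$; $K_1$ is the one-vertex graph. For a graph $G=(V,E)$, $d_{G,2}(x,y)=\min\{d_G(x,y),2\}$ with $d_G$ the shortest-path distance ($\infty$ between different components). For distinct $x,y$, $\mathcal{C}_G(x,y)=\{z\in V: d_{G,2}(x,z)\ne d_{G,2}(y,z)\}$ and $\mathcal{C}(G)=\min_{x\ne y}|\mathcal{C}_G(x,y)|$. A set $S\subseteq V$ is a $k$-adjacency generator if $|S\cap\mathcal{C}_G(x,y)|\ge k$ for all distinct $x,y$; $\operatorname{adim}_k(G)$ is the minimum cardinality of such a set (it exists exactly when $k\le\mathcal{C}(G)$). -}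

module Defs where

open import Data.Bool using (Bool; true; false; if_then_else_)
open import Data.Nat using (ℕ; zero; suc; _≤_)
open import Data.Fin using (Fin; zero; suc; _≟_)
open import Data.Fin.Subset using (Subset; _∩_; ∣_∣; inside; outside)
open import Data.Vec using (tabulate)
open import Data.Product using (Σ; _×_)
open import Relation.Nullary using (¬_; yes; no)
open import Relation.Binary.PropositionalEquality using (_≡_)

record Graph (n : ℕ) : Set where
  field
    Adj   : Fin n → Fin n → Bool
    sym   : ∀ x y → Adj x y ≡ Adj y x
    irrefl : ∀ x → Adj x x ≡ false
open Graph public

-- The join K₁ + H: vertex 'zero' is the vertex of K₁, 'suc i' is vertex i of H.
K₁+ : ∀ {n} → Graph n → Graph (suc n)
K₁+ {n} H = record { Adj = adj ; sym = s ; irrefl = ir }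
  where
  adj : Fin (suc n) → Fin (suc n) → Bool
  adj zero    zero    = false
  adj zero    (suc _) = true
  adj (suc _) zero    = true
  adj (suc i) (suc j) = Adj H i j
  s : ∀ x y → adj x y ≡ adj y x
  s zero    zero    = _≡_.refl
  s zero    (suc _) = _≡_.refl
  s (suc _) zero    = _≡_.refl
  s (suc i) (suc j) = sym H i j
  ir : ∀ x → adj x x ≡ false
  ir zero    = _≡_.refl
  ir (suc i) = irrefl H i

-- d_{G,2}(x,y) = min{d_G(x,y), 2}: 0 if x = y, 1 if x,y adjacent, 2 otherwise.
d₂ : ∀ {n} → Graph n → Fin n → Fin n → ℕ
d₂ G x y with x ≟ y
... | yes _ = 0
... | no  _ = if Adj G x y then 1 else 2

𝒞 : ∀ {n} → Graph n → Fin n → Fin n → Subset n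
𝒞 G x y = tabulate λ z → differ (d₂ G x z) (d₂ G y z)
  where
  differ : ℕ → ℕ → Bool
  differ a b with a Data.Nat.≟ b
  ... | yes _ = outside
  ... | no  _ = inside

k≤𝒞 : ∀ {n} → Graph n → ℕ → Set
k≤𝒞 G k = ∀ x y → ¬ x ≡ y → k ≤ ∣ 𝒞 G x y ∣

IsAdjGen : ∀ {n} → Graph n → ℕ → Subset n → Set
IsAdjGen G k S = ∀ x y → ¬ x ≡ y → k ≤ ∣ S ∩ 𝒞 G x y ∣

IsAdim : ∀ {n} → Graph n → ℕ → ℕ → Set
IsAdim G k m =
  Σ (Subset _) (λ S → IsAdjGen G k S × ∣ S ∣ ≡ m)
  × (∀ S → IsAdjGen G k S → m ≤ ∣ S ∣)

-- Two vertices x, y of H are adjacent to the apex of K₁ + H, so the apex never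
-- distinguishes them, while on V(H) the truncated distances of K₁ + H and of H
-- agree. Hence dropping the apex from a k-adjacency generator of K₁ + H leaves a
-- k-adjacency generator of H that is no larger, and adim_k(H) is at most its size.
module Submission where

open import Defs hiding (sym)
open import Data.Bool using (true; false; not)
open import Data.Fin using (zero; suc; _≟_)
open import Data.Fin.Subset using (Subset; _∩_; ∣_∣; outside)
open import Data.Fin.Subset.Properties using (∣p∣≤∣x∷p∣; anySubset?)
open import Data.Fin.Properties using (all?)
import Data.Nat as ℕ
open import Data.Nat using (ℕ; _≤_; _<_; _≤?_; _<?_)
open import Data.Nat.Induction using (<-wellFounded)
open import Data.Nat.Properties using (≤-refl; ≤-trans; <⇒≤; ≮⇒≥)
open import Data.Product using (Σ; Σ-syntax; _×_; _,_)
open import Data.Vec using (_∷_; lookup)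
open import Data.Vec.Properties using (lookup∘tabulate)
open import Data.Vec.Relation.Binary.Pointwise.Extensional using (ext; Pointwise-≡⇒≡)
open import Function using (_∋_; _on_)
open import Induction.WellFounded using (Acc; acc)
open import Relation.Binary.Construct.On using (wellFounded)
open import Relation.Binary.PropositionalEquality
  using (_≡_; refl; sym; cong₂; subst; module ≡-Reasoning)
open import Relation.Nullary using (yes; no; ¬?)
open import Relation.Nullary.Decidable using (⌊_⌋; _→-dec_; _×-dec_)
open import Relation.Unary using (Pred; Decidable)

d₂-K₁+ : ∀ {n} (H : Graph n) x z → d₂ (K₁+ H) (suc x) (suc z) ≡ d₂ H x z
d₂-K₁+ H x z with x ≟ z
... | yes refl = refl
... | no  _    = refl

lookup-𝒞 : ∀ {n} (G : Graph n) x y z →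
           lookup (𝒞 G x y) z ≡ not ⌊ d₂ G x z ℕ.≟ d₂ G y z ⌋
-- The annotation lets Agda unfold 𝒞 to the tabulated function it is built from.
lookup-𝒞 G x y z with d₂ G x z ℕ.≟ d₂ G y z | (lookup (𝒞 G x y) z ≡ _ ∋ lookup∘tabulate _ z)
... | yes _ | entry = entry
... | no  _ | entry = entry

𝒞-K₁+ : ∀ {n} (H : Graph n) x y → 𝒞 (K₁+ H) (suc x) (suc y) ≡ outside ∷ 𝒞 H x y
𝒞-K₁+ H x y = Pointwise-≡⇒≡ (ext entry)
  where
  open ≡-Reasoning
  entry : ∀ z → lookup (𝒞 (K₁+ H) (suc x) (suc y)) z ≡ lookup (outside ∷ 𝒞 H x y) z
  entry zero    = refl
  entry (suc z) = begin
    lookup (𝒞 (K₁+ H) (suc x) (suc y)) (suc z)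
      ≡⟨ lookup-𝒞 (K₁+ H) (suc x) (suc y) (suc z) ⟩
    not ⌊ d₂ (K₁+ H) (suc x) (suc z) ℕ.≟ d₂ (K₁+ H) (suc y) (suc z) ⌋
      ≡⟨ cong₂ (λ a b → not ⌊ a ℕ.≟ b ⌋) (d₂-K₁+ H x z) (d₂-K₁+ H y z) ⟩
    not ⌊ d₂ H x z ℕ.≟ d₂ H y z ⌋
      ≡⟨ sym (lookup-𝒞 H x y z) ⟩
    lookup (𝒞 H x y) z
      ∎

∣x∷p∩outside∷q∣≡∣p∩q∣ : ∀ {n} x (p q : Subset n) → ∣ (x ∷ p) ∩ (outside ∷ q) ∣ ≡ ∣ p ∩ q ∣
∣x∷p∩outside∷q∣≡∣p∩q∣ true  p q = refl
∣x∷p∩outside∷q∣≡∣p∩q∣ false p q = refl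

IsAdjGen-K₁+⇒IsAdjGen : ∀ {n} (H : Graph n) k x S → IsAdjGen (K₁+ H) k (x ∷ S) → IsAdjGen H k S
IsAdjGen-K₁+⇒IsAdjGen H k x S gen u v u≢v =
  subst (k ≤_) (∣x∷p∩outside∷q∣≡∣p∩q∣ x S (𝒞 H u v))
    (subst (λ C → k ≤ ∣ (x ∷ S) ∩ C ∣) (𝒞-K₁+ H u v)
      (gen (suc u) (suc v) λ { refl → u≢v refl }))

module _ {n ℓ} {P : Pred (Subset n) ℓ} (P? : Decidable P) where

  minimal-cardinality : ∀ T → P T →
    Σ[ S ∈ Subset n ] P S × ∣ S ∣ ≤ ∣ T ∣ × (∀ S′ → P S′ → ∣ S ∣ ≤ ∣ S′ ∣)
  minimal-cardinality T pT = go T pT (wellFounded ∣_∣ <-wellFounded T)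
    where
    go : ∀ T → P T → Acc (_<_ on ∣_∣) T →
         Σ[ S ∈ Subset n ] P S × ∣ S ∣ ≤ ∣ T ∣ × (∀ S′ → P S′ → ∣ S ∣ ≤ ∣ S′ ∣)
    go T pT (acc smaller) with anySubset? (λ S → P? S ×-dec (∣ S ∣ <? ∣ T ∣))
    ... | yes (S , pS , S<T) =
      let (M , pM , M≤S , minM) = go S pS (smaller S<T)
      in M , pM , ≤-trans M≤S (<⇒≤ S<T) , minM
    ... | no ∄smaller = T , pT , ≤-refl , λ S′ pS′ → ≮⇒≥ λ S′<T → ∄smaller (S′ , pS′ , S′<T)

IsAdjGen? : ∀ {n} (G : Graph n) k → Decidable (IsAdjGen G k)
IsAdjGen? G k S = all? λ x → all? λ y → ¬? (x ≟ y) →-dec (k ≤? ∣ S ∩ 𝒞 G x y ∣)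

adim-≤-generator : ∀ {n} (G : Graph n) k S → IsAdjGen G k S →
                   Σ ℕ λ b → IsAdim G k b × b ≤ ∣ S ∣
adim-≤-generator G k S gen =
  let (M , genM , M≤S , minM) = minimal-cardinality (IsAdjGen? G k) S gen
  in ∣ M ∣ , ((M , genM , refl) , minM) , M≤S

-- Only the existence of adim_k(K₁ + H) is used; the remaining hypotheses of the
-- paper merely guarantee it.
proposition25 : ∀ (n : ℕ) (H : Graph n) → 2 ≤ n → (k : ℕ) → 1 ≤ k → k≤𝒞 (K₁+ H) k
    → (a : ℕ) → IsAdim (K₁+ H) k a → Σ ℕ (λ b → IsAdim H k b × b ≤ a)
proposition25 n H _ k _ _ a ((x ∷ S , gen , ∣x∷S∣≡a) , _) =
  let (b , adim , b≤∣S∣) = adim-≤-generator H k S (IsAdjGen-K₁+⇒IsAdjGen H k x S gen)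
  in b , adim , ≤-trans b≤∣S∣ (subst (∣ S ∣ ≤_) ∣x∷S∣≡a (∣p∣≤∣x∷p∣ x S))
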